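{- Let $\mathbf L=(L,\vee,\wedge,{}^*,0,1)$ be a pseudocomplemented lattice, define $x\Rightarrow y:=x^*\vee y^{**}$ for $x,y\in L$, and let $a,b,c\in L$. Then: (i) $a\Rightarrow b\le a\Rightarrow(a\Rightarrow b)$; (ii) if $a\le b$ then $c\Rightarrow a\le c\Rightarrow b$ and $b\Rightarrow c\le a\Rightarrow c$; (iii) if $a\le b$ then $a\Rightarrow b\in D(\mathbf L)$; (iv) $(a\Rightarrow b)\Rightarrow a=a^{**}$.
   Context: A bounded lattice $(L,\vee,\wedge,0,1)$ is pseudocomplemented if for each $a\in L$ there is a greatest element $a^*\in L$ with $a\wedge a^*=0$; $a^*$ is the pseudocomplement of $a$, and $a^{**}=(a^*)^*$. An element $a$ is dense if $a^*=0$; $D(\mathbf L)$ denotes the set of dense elements. -}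

module Defs where

open import Level using (Level; suc; _⊔_)
open import Algebra.Lattice.Bundles using (Lattice)
open import Data.Product using (_×_)

record PseudocomplementedLattice (c ℓ : Level) : Set (suc (c ⊔ ℓ)) where
  field
    lattice : Lattice c ℓ
  open Lattice lattice public
  infix 4 _≤_
  _≤_ : Carrier → Carrier → Set ℓ
  x ≤ y = (x ∧ y) ≈ x
  infix 8 _*
  field
    ⊥L : Carrier
    ⊤L : Carrier
    ⊥L-least : ∀ x → ⊥L ≤ x
    ⊤L-greatest : ∀ x → x ≤ ⊤L
    _* : Carrier → Carrier
    *-meet : ∀ a → (a ∧ (a *)) ≈ ⊥L
    *-greatest : ∀ a x → (a ∧ x) ≈ ⊥L → x ≤ (a *)

  infixr 5 _⇒_
  _⇒_ : Carrier → Carrier → Carrier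
  x ⇒ y = (x *) ∨ ((y *) *)

  Dense : Carrier → Set ℓ
  Dense a = (a *) ≈ ⊥L

-- The pseudocomplement is antitone and x ≤ x**, so ** is monotone and
-- x*** ≤ x*. Everything then follows from bounds on x ⇒ y = x* ∨ y**:
-- (i) holds as y ≤ y**; for (iii), (a ⇒ b)* ≤ a** ∧ b*** ≤ b** ∧ b* = 0
-- when a ≤ b; for (iv), (a ⇒ b)* ≤ a** collapses the join (a ⇒ b)* ∨ a**.
module Submission where

open import Defs
open import Data.Product using (_×_; _,_)
import Algebra.Lattice.Properties.Lattice as LatticeProperties
import Relation.Binary.Lattice as OrderLattice

module PseudocomplementProperties {ℓ₁ ℓ₂} (L : PseudocomplementedLattice ℓ₁ ℓ₂) where
  open PseudocomplementedLattice L

  private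
    module O = OrderLattice.Lattice
      (LatticeProperties.∨-∧-orderTheoreticLattice lattice)

    -- The library orders by x ≈ x ∧ y, the record by x ∧ y ≈ x.
    fromO : ∀ {x y} → O._≤_ x y → x ≤ y
    fromO = sym

    toO : ∀ {x y} → x ≤ y → O._≤_ x y
    toO = sym

  ≤-refl : ∀ {x} → x ≤ x
  ≤-refl = fromO O.refl

  ≤-reflexive : ∀ {x y} → x ≈ y → x ≤ y
  ≤-reflexive e = fromO (O.reflexive e)

  ≤-trans : ∀ {x y z} → x ≤ y → y ≤ z → x ≤ z
  ≤-trans p q = fromO (O.trans (toO p) (toO q))

  ≤-antisym : ∀ {x y} → x ≤ y → y ≤ x → x ≈ y
  ≤-antisym p q = O.antisym (toO p) (toO q)

  x≤x∨y : ∀ x y → x ≤ x ∨ y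
  x≤x∨y x y = fromO (O.x≤x∨y x y)

  y≤x∨y : ∀ x y → y ≤ x ∨ y
  y≤x∨y x y = fromO (O.y≤x∨y x y)

  ∨-least : ∀ {x y z} → x ≤ z → y ≤ z → x ∨ y ≤ z
  ∨-least p q = fromO (O.∨-least (toO p) (toO q))

  x∧y≤x : ∀ x y → x ∧ y ≤ x
  x∧y≤x x y = fromO (O.x∧y≤x x y)

  x∧y≤y : ∀ x y → x ∧ y ≤ y
  x∧y≤y x y = fromO (O.x∧y≤y x y)

  ∧-greatest : ∀ {x y z} → z ≤ x → z ≤ y → z ≤ x ∧ y
  ∧-greatest p q = fromO (O.∧-greatest (toO p) (toO q))

  x≤y⇒x∨y≈y : ∀ {x y} → x ≤ y → x ∨ y ≈ y
  x≤y⇒x∨y≈y p = ≤-antisym (∨-least p ≤-refl) (y≤x∨y _ _)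

  ≤⊥⇒≈⊥ : ∀ {x} → x ≤ ⊥L → x ≈ ⊥L
  ≤⊥⇒≈⊥ p = ≤-antisym p (⊥L-least _)

  *-meetˡ : ∀ a → a * ∧ a ≈ ⊥L
  *-meetˡ a = trans (∧-comm (a *) a) (*-meet a)

  *-antitone : ∀ {x y} → x ≤ y → y * ≤ x *
  *-antitone {x} {y} x≤y = *-greatest x (y *) (≤⊥⇒≈⊥ x∧y*≤⊥)
    where
    x∧y*≤⊥ : x ∧ y * ≤ ⊥L
    x∧y*≤⊥ = ≤-trans
      (∧-greatest (≤-trans (x∧y≤x x (y *)) x≤y) (x∧y≤y x (y *)))
      (≤-reflexive (*-meet y))

  x≤x** : ∀ x → x ≤ x * *
  x≤x** x = *-greatest (x *) x (*-meetˡ x)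

  **-monotone : ∀ {x y} → x ≤ y → x * * ≤ y * *
  **-monotone p = *-antitone (*-antitone p)

  x***≤x* : ∀ x → x * * * ≤ x *
  x***≤x* x = *-antitone (x≤x** x)

  [x⇒y]*≤x** : ∀ x y → (x ⇒ y) * ≤ x * *
  [x⇒y]*≤x** x y = *-antitone (x≤x∨y (x *) (y * *))

  [x⇒y]*≤y* : ∀ x y → (x ⇒ y) * ≤ y *
  [x⇒y]*≤y* x y = ≤-trans (*-antitone (y≤x∨y (x *) (y * *))) (x***≤x* y)

  ⇒-≤-⇒-⇒ : ∀ a b → a ⇒ b ≤ a ⇒ (a ⇒ b)
  ⇒-≤-⇒-⇒ a b = ≤-trans (x≤x** (a ⇒ b)) (y≤x∨y _ _)

  ⇒-monotoneʳ : ∀ {a b} c → a ≤ b → c ⇒ a ≤ c ⇒ b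
  ⇒-monotoneʳ c a≤b = ∨-least (x≤x∨y _ _) (≤-trans (**-monotone a≤b) (y≤x∨y _ _))

  ⇒-antitoneˡ : ∀ {a b} c → a ≤ b → b ⇒ c ≤ a ⇒ c
  ⇒-antitoneˡ c a≤b = ∨-least (≤-trans (*-antitone a≤b) (x≤x∨y _ _)) (y≤x∨y _ _)

  ≤⇒⇒-dense : ∀ {a b} → a ≤ b → Dense (a ⇒ b)
  ≤⇒⇒-dense {a} {b} a≤b = ≤⊥⇒≈⊥ (≤-trans
    (∧-greatest (≤-trans ([x⇒y]*≤x** a b) (**-monotone a≤b)) ([x⇒y]*≤y* a b))
    (≤-reflexive (*-meetˡ (b *))))

  ⇒-⇒-≈-** : ∀ a b → (a ⇒ b) ⇒ a ≈ a * *
  ⇒-⇒-≈-** a b = x≤y⇒x∨y≈y ([x⇒y]*≤x** a b)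

lemma4p3 : ∀ {ℓ₁ ℓ₂} (L : PseudocomplementedLattice ℓ₁ ℓ₂) →
    let open PseudocomplementedLattice L in
    ∀ (a b c : Carrier) →
      ((a ⇒ b) ≤ (a ⇒ (a ⇒ b)))
      × (a ≤ b → ((c ⇒ a) ≤ (c ⇒ b)) × ((b ⇒ c) ≤ (a ⇒ c)))
      × (a ≤ b → Dense (a ⇒ b))
      × (((a ⇒ b) ⇒ a) ≈ ((a *) *))
lemma4p3 L a b c =
    ⇒-≤-⇒-⇒ a b
  , (λ a≤b → ⇒-monotoneʳ c a≤b , ⇒-antitoneˡ c a≤b)
  , ≤⇒⇒-dense
  , ⇒-⇒-≈-** a b
  where open PseudocomplementProperties L
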